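{- Let $x_1,x_2,y$ be nonzero complex numbers with $x_1\neq x_2$. Then for every integer $n\geq 0$, $$\sum_{k=0}^{n}\binom{n}{k}\mathfrak{F}_{k}(x_1,y)\,\mathfrak{F}_{n-k}(x_2,y)=\frac{x_2\,\mathfrak{F}_{n}(x_2,y)-x_1\,\mathfrak{F}_{n}(x_1,y)}{x_2-x_1}.$$
   Context: The generalized Fubini polynomials $\mathfrak{F}_n(x,y)$ are defined by $\sum_{n\geq0}\mathfrak{F}_n(x,y)\frac{t^n}{n!}=\frac{1}{1-\frac{x}{y}(e^{ty}-1)}$; equivalently $\mathfrak{F}_n(x,y)=\sum_{k=0}^n{n\brace k}k!x^ky^{n-k}$ with ${n\brace k}$ the Stirling numbers of the second kind. -}

module Defs where

open import Level using (Level)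
open import Data.Nat as ℕ using (ℕ; zero; suc; _∸_)
open import Data.Nat.Combinatorics using (_C_)
open import Algebra.Bundles using (CommutativeRing; Semiring)
import Algebra.Definitions.RawSemiring as RS

stirling2 : ℕ → ℕ → ℕ
stirling2 zero    zero    = 1
stirling2 zero    (suc k) = 0
stirling2 (suc n) zero    = 0
stirling2 (suc n) (suc k) = suc k ℕ.* stirling2 n (suc k) ℕ.+ stirling2 n k

module FubiniDefs {c ℓ : Level} (R : CommutativeRing c ℓ) where
  open CommutativeRing R
  open RS (Semiring.rawSemiring semiring) using (_^_; _×_)

  sumTo : ℕ → (ℕ → Carrier) → Carrier
  sumTo zero    f = f 0
  sumTo (suc n) f = sumTo n f + f (suc n)

  fubini : ℕ → Carrier → Carrier → Carrier
  fubini n x y = sumTo n (λ k → (stirling2 n k ℕ.* (k ℕ.!)) × ((x ^ k) * (y ^ (n ∸ k))))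

  convolution : ℕ → Carrier → Carrier → Carrier → Carrier
  convolution n x₁ x₂ y =
    sumTo n (λ k → (n C k) × (fubini k x₁ y * fubini (n ∸ k) x₂ y))

-- Read z ↦ Σₖ S(n,k) k! zₖ yⁿ⁻ᵏ as a linear functional Lₙ on coefficient
-- sequences, so that Fₙ(x,y) = Lₙ(1, x, x², …).  Since Σₙ S(n,k) yⁿ⁻ᵏ tⁿ/n!
-- is uᵏ/k! with u = (e^{yt} − 1)/y, the exponential generating function of
-- Lₙ(z) is Z(u(t)) for Z(u) = Σ zₖ uᵏ; as du/dt = 1 + yu, this gives
-- Lₙ₊₁ = Lₙ ∘ ∂ with ∂ = (1 + yu) d/du, i.e. Lₙ(z) = (∂ⁿ z)₀.  The operator ∂
-- is a derivation of the Cauchy product ⋆, so the Leibniz rule turns the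
-- binomial convolution of Fₖ(x₁,y) and Fₙ₋ₖ(x₂,y) into (∂ⁿ(z₁ ⋆ z₂))₀ for the
-- geometric sequences z₁, z₂ of x₁, x₂.  Their Cauchy product is the sequence
-- (x₂ᵐ⁺¹ − x₁ᵐ⁺¹)/(x₂ − x₁), and linearity of ∂ⁿ finishes the proof.
module Submission where

open import Defs
open import Level using (Level)
open import Function using (_∘_)
open import Data.Nat as ℕ using (ℕ; zero; suc; _∸_; _≤_; _<_; s≤s; _!)
import Data.Nat.Properties as ℕ
open import Data.Nat.Combinatorics using (_C_; nCk+nC[k+1]≡[n+1]C[k+1]; k>n⇒nCk≡0)
open import Algebra.Bundles using (CommutativeRing; Semiring)
import Algebra.Definitions.RawSemiring as RawSemiring
import Algebra.Properties.CommutativeSemigroup as CommutativeSemigroupProperties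
open import Relation.Binary.PropositionalEquality as ≡ using (_≡_)
open import Relation.Nullary using (¬_)

stirling2-vanishes : ∀ {n k} → n < k → stirling2 n k ≡ 0
stirling2-vanishes {zero}  {suc k} _         = ≡.refl
stirling2-vanishes {suc n} {suc k} (s≤s n<k)
  rewrite stirling2-vanishes (ℕ.m<n⇒m<1+n n<k) | stirling2-vanishes n<k
  = ≡.trans (ℕ.+-identityʳ (suc k ℕ.* 0)) (ℕ.*-zeroʳ (suc k))

surjections : ℕ → ℕ → ℕ
surjections n k = stirling2 n k ℕ.* k !

surjections-vanishes : ∀ {n k} → n < k → surjections n k ≡ 0
surjections-vanishes {k = k} n<k = ≡.cong (ℕ._* k !) (stirling2-vanishes n<k)

surjections-suc : ∀ n j →
  surjections (suc n) (suc j) ≡ (surjections n (suc j) ℕ.+ surjections n j) ℕ.* suc j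
surjections-suc n j = identity (stirling2 n (suc j)) (stirling2 n j) (j !) (suc j)
  where
  open import Data.Nat.Tactic.RingSolver using (solve-∀)
  identity : ∀ s t f m → (m ℕ.* s ℕ.+ t) ℕ.* (m ℕ.* f) ≡ (s ℕ.* (m ℕ.* f) ℕ.+ t ℕ.* f) ℕ.* m
  identity = solve-∀

module FubiniConvolution {c ℓ : Level} (R : CommutativeRing c ℓ) where
  open CommutativeRing R
  open FubiniDefs R
  open RawSemiring (Semiring.rawSemiring semiring) using (_^_; _×_)
  open import Algebra.Properties.Semiring.Mult semiring
    using (×-congˡ; ×-congʳ; ×-cong; ×-homo-+; ×-comm-*; ×-assoc-*; ×-assocˡ)
  open import Algebra.Properties.CommutativeMonoid.Mult +-commutativeMonoid
    using (×-distrib-+)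
  open import Algebra.Properties.Ring ring using (-‿distribˡ-*)
  open CommutativeSemigroupProperties +-commutativeSemigroup
    using () renaming (interchange to +-interchange; x∙yz≈y∙xz to +-leftComm; x∙yz≈yx∙z to +-x∙yz≈yx∙z)
  open import Algebra.Properties.AbelianGroup +-abelianGroup using (xyx⁻¹≈y)
  open CommutativeSemigroupProperties *-commutativeSemigroup
    using () renaming (x∙yz≈y∙xz to *-leftComm; xy∙z≈y∙xz to *-xy∙z≈y∙xz)
  open import Relation.Binary.Reasoning.Setoid setoid

  ×-zeroʳ : ∀ m → m × 0# ≈ 0#
  ×-zeroʳ zero    = refl
  ×-zeroʳ (suc m) = trans (+-identityˡ _) (×-zeroʳ m)

  sumTo-cong : ∀ n {f g : ℕ → Carrier} → (∀ k → k ≤ n → f k ≈ g k) → sumTo n f ≈ sumTo n g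
  sumTo-cong zero    f≈g = f≈g 0 ℕ.z≤n
  sumTo-cong (suc n) f≈g =
    +-cong (sumTo-cong n (λ k k≤n → f≈g k (ℕ.m≤n⇒m≤1+n k≤n))) (f≈g (suc n) ℕ.≤-refl)

  sumTo-+ : ∀ n (f g : ℕ → Carrier) → sumTo n (λ k → f k + g k) ≈ sumTo n f + sumTo n g
  sumTo-+ zero    f g = refl
  sumTo-+ (suc n) f g = trans (+-congʳ (sumTo-+ n f g)) (+-interchange _ _ _ _)

  *-distribˡ-sumTo : ∀ n a (f : ℕ → Carrier) → a * sumTo n f ≈ sumTo n (λ k → a * f k)
  *-distribˡ-sumTo zero    a f = refl
  *-distribˡ-sumTo (suc n) a f = trans (distribˡ _ _ _) (+-congʳ (*-distribˡ-sumTo n a f))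

  ×-distribˡ-sumTo : ∀ n m (f : ℕ → Carrier) → m × sumTo n f ≈ sumTo n (λ k → m × f k)
  ×-distribˡ-sumTo zero    m f = refl
  ×-distribˡ-sumTo (suc n) m f = trans (×-distrib-+ _ _ m) (+-congʳ (×-distribˡ-sumTo n m f))

  sumTo-head : ∀ n (f : ℕ → Carrier) → sumTo (suc n) f ≈ f 0 + sumTo n (f ∘ suc)
  sumTo-head zero    f = refl
  sumTo-head (suc n) f = trans (+-congʳ (sumTo-head n f)) (+-assoc _ _ _)

  sumTo-dropFirst : ∀ n (f : ℕ → Carrier) → f 0 ≈ 0# → sumTo (suc n) f ≈ sumTo n (f ∘ suc)
  sumTo-dropFirst n f f0≈0 = trans (sumTo-head n f) (trans (+-congʳ f0≈0) (+-identityˡ _))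

  sumTo-dropLast : ∀ n (f : ℕ → Carrier) → f (suc n) ≈ 0# → sumTo (suc n) f ≈ sumTo n f
  sumTo-dropLast n f fn≈0 = trans (+-congˡ fn≈0) (+-identityʳ _)

  sumTo-reindex : ∀ n (f : ℕ → Carrier) → f 0 ≈ 0# → f (suc n) ≈ 0# →
                  sumTo n f ≈ sumTo n (f ∘ suc)
  sumTo-reindex n f f0≈0 fn≈0 = trans (sym (sumTo-dropLast n f fn≈0)) (sumTo-dropFirst n f f0≈0)

  sumTo-complementaryWeights : ∀ m (f : ℕ → Carrier) →
    sumTo m (λ i → i × f i) + sumTo m (λ i → (m ∸ i) × f i) ≈ m × sumTo m f
  sumTo-complementaryWeights m f = begin
    sumTo m (λ i → i × f i) + sumTo m (λ i → (m ∸ i) × f i)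
      ≈⟨ sym (sumTo-+ m _ _) ⟩
    sumTo m (λ i → i × f i + (m ∸ i) × f i)
      ≈⟨ sumTo-cong m (λ i i≤m → trans (sym (×-homo-+ (f i) i (m ∸ i))) (×-congˡ (ℕ.m+[n∸m]≡n i≤m))) ⟩
    sumTo m (λ i → m × f i)
      ≈⟨ sym (×-distribˡ-sumTo m m f) ⟩
    m × sumTo m f ∎

  binomialConvolution : ℕ → (ℕ → Carrier) → (ℕ → Carrier) → Carrier
  binomialConvolution n g h = sumTo n (λ k → (n C k) × (g k * h (n ∸ k)))

  binomialConvolution-suc : ∀ n (g h : ℕ → Carrier) →
    binomialConvolution (suc n) g h ≈ binomialConvolution n (g ∘ suc) h + binomialConvolution n g (h ∘ suc)
  binomialConvolution-suc n g h = begin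
    binomialConvolution (suc n) g h
      ≈⟨ sumTo-head n _ ⟩
    F 0 + sumTo n (λ j → (suc n C suc j) × (g (suc j) * h (n ∸ j)))
      ≈⟨ +-congˡ (sumTo-cong n (λ j _ → pascal j)) ⟩
    F 0 + sumTo n (λ j → A j + F (suc j))
      ≈⟨ trans (+-congˡ (sumTo-+ n A (F ∘ suc))) (+-leftComm _ _ _) ⟩
    sumTo n A + (F 0 + sumTo n (F ∘ suc))
      ≈⟨ +-congˡ (sym (sumTo-head n F)) ⟩
    sumTo n A + sumTo (suc n) F
      ≈⟨ +-congˡ (sumTo-dropLast n F (×-congˡ (k>n⇒nCk≡0 (ℕ.n<1+n n)))) ⟩
    sumTo n A + sumTo n F
      ≈⟨ +-congˡ (sumTo-cong n (λ k k≤n → ×-congʳ (n C k) (*-congˡ (reflexive (≡.cong h (ℕ.+-∸-assoc 1 k≤n)))))) ⟩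
    binomialConvolution n (g ∘ suc) h + binomialConvolution n g (h ∘ suc) ∎
    where
    A F : ℕ → Carrier
    A k = (n C k) × (g (suc k) * h (n ∸ k))
    F k = (n C k) × (g k * h (suc n ∸ k))
    pascal : ∀ j → (suc n C suc j) × (g (suc j) * h (n ∸ j)) ≈ A j + F (suc j)
    pascal j = trans (×-congˡ (≡.sym (nCk+nC[k+1]≡[n+1]C[k+1] n j))) (×-homo-+ _ (n C j) (n C suc j))

  Seq : Set c
  Seq = ℕ → Carrier

  infix 4 _≐_
  _≐_ : Seq → Seq → Set ℓ
  z ≐ w = ∀ k → z k ≈ w k

  infixl 7 _⋆_
  _⋆_ : Seq → Seq → Seq
  (z ⋆ w) m = sumTo m (λ i → z i * w (m ∸ i))

  powers : Carrier → Seq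
  powers x k = x ^ k

  powers-⋆-last : ∀ a b m → (powers a ⋆ powers b) (suc m) ≈ b * (powers a ⋆ powers b) m + a ^ suc m
  powers-⋆-last a b m = +-cong
    (trans (sumTo-cong m (λ i i≤m → trans (*-congˡ (reflexive (≡.cong (b ^_) (ℕ.+-∸-assoc 1 i≤m))))
                                          (*-leftComm (a ^ i) b _)))
           (sym (*-distribˡ-sumTo m b _)))
    (trans (*-congˡ (reflexive (≡.cong (b ^_) (ℕ.n∸n≡0 m)))) (*-identityʳ _))

  powers-⋆-first : ∀ a b m → (powers a ⋆ powers b) (suc m) ≈ b ^ suc m + a * (powers a ⋆ powers b) m
  powers-⋆-first a b m = trans (sumTo-head m _)
    (+-cong (*-identityˡ _) (trans (sumTo-cong m (λ i _ → *-assoc a (a ^ i) _)) (sym (*-distribˡ-sumTo m a _))))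

  powers-⋆-telescope : ∀ a b m →
    b * (powers a ⋆ powers b) m + a ^ suc m ≈ a * (powers a ⋆ powers b) m + b ^ suc m
  powers-⋆-telescope a b m =
    trans (sym (powers-⋆-last a b m)) (trans (powers-⋆-first a b m) (+-comm _ _))

  +-transpose : ∀ {x y p q} → x + p ≈ y + q → x - y ≈ q - p
  +-transpose {x} {y} {p} {q} x+p≈y+q = begin
    x - y             ≈⟨ sym (xyx⁻¹≈y p (x - y)) ⟩
    p + (x - y) - p   ≈⟨ +-congʳ (+-x∙yz≈yx∙z p x (- y)) ⟩
    x + p - y - p     ≈⟨ +-congʳ (+-congʳ x+p≈y+q) ⟩
    y + q - y - p     ≈⟨ +-congʳ (xyx⁻¹≈y y q) ⟩
    q - p             ∎

  powers-⋆-geometric : ∀ a b m → (b - a) * (powers a ⋆ powers b) m ≈ b ^ suc m - a ^ suc m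
  powers-⋆-geometric a b m = begin
    (b - a) * S                     ≈⟨ trans (distribʳ S b (- a)) (+-congˡ (sym (-‿distribˡ-* a S))) ⟩
    b * S - a * S                   ≈⟨ +-transpose (powers-⋆-telescope a b m) ⟩
    b ^ suc m - a ^ suc m           ∎
    where S = (powers a ⋆ powers b) m

  module Derivation (y : Carrier) where

    ∂ : Seq → Seq
    ∂ z k = k × (y * z k) + suc k × z (suc k)

    ∂-cong : ∀ {z w} → z ≐ w → ∂ z ≐ ∂ w
    ∂-cong z≐w k = +-cong (×-congʳ k (*-congˡ (z≐w k))) (×-congʳ (suc k) (z≐w (suc k)))

    ∂-+ : ∀ z w → ∂ (λ i → z i + w i) ≐ λ k → ∂ z k + ∂ w k
    ∂-+ z w k = trans
      (+-cong (trans (×-congʳ k (distribˡ y _ _)) (×-distrib-+ _ _ k)) (×-distrib-+ _ _ (suc k)))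
      (+-interchange _ _ _ _)

    ∂-*ˡ : ∀ a z → ∂ (λ i → a * z i) ≐ λ k → a * ∂ z k
    ∂-*ˡ a z k = begin
      k × (y * (a * z k)) + suc k × (a * z (suc k))
        ≈⟨ +-congʳ (×-congʳ k (*-leftComm y a (z k))) ⟩
      k × (a * (y * z k)) + suc k × (a * z (suc k))
        ≈⟨ sym (+-cong (×-comm-* k a _) (×-comm-* (suc k) a _)) ⟩
      a * (k × (y * z k)) + a * (suc k × z (suc k))
        ≈⟨ sym (distribˡ a _ _) ⟩
      a * ∂ z k ∎

    ∂-leibniz : ∀ z w → ∂ (z ⋆ w) ≐ λ m → (∂ z ⋆ w) m + (z ⋆ ∂ w) m
    ∂-leibniz z w m = sym (begin
      (∂ z ⋆ w) m + (z ⋆ ∂ w) m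
        ≈⟨ +-cong (sumTo-cong m (λ i _ → expandˡ i)) (sumTo-cong m expandʳ) ⟩
      sumTo m (λ i → i × Y i + suc i × G (suc i)) + sumTo m (λ i → (m ∸ i) × Y i + (suc m ∸ i) × G i)
        ≈⟨ trans (+-cong (sumTo-+ m _ _) (sumTo-+ m _ _)) (+-interchange _ _ _ _) ⟩
      (sumTo m (λ i → i × Y i) + sumTo m (λ i → (m ∸ i) × Y i))
        + (sumTo m (λ i → suc i × G (suc i)) + sumTo m (λ i → (suc m ∸ i) × G i))
        ≈⟨ +-cong (sumTo-complementaryWeights m Y)
                  (+-cong (sym (sumTo-dropFirst m (λ i → i × G i) refl))
                          (sym (sumTo-dropLast m (λ i → (suc m ∸ i) × G i) (×-congˡ (ℕ.n∸n≡0 m))))) ⟩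
      m × sumTo m Y + (sumTo (suc m) (λ i → i × G i) + sumTo (suc m) (λ i → (suc m ∸ i) × G i))
        ≈⟨ +-cong (×-congʳ m (sym (*-distribˡ-sumTo m y _))) (sumTo-complementaryWeights (suc m) G) ⟩
      ∂ (z ⋆ w) m ∎)
      where
      Y G : ℕ → Carrier
      Y i = y * (z i * w (m ∸ i))
      G i = z i * w (suc m ∸ i)
      expandˡ : ∀ i → ∂ z i * w (m ∸ i) ≈ i × Y i + suc i × G (suc i)
      expandˡ i = trans (distribʳ _ _ _)
        (+-cong (trans (×-assoc-* i _ _) (×-congʳ i (*-assoc _ _ _))) (×-assoc-* (suc i) _ _))
      expandʳ : ∀ i → i ≤ m → z i * ∂ w (m ∸ i) ≈ (m ∸ i) × Y i + (suc m ∸ i) × G i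
      expandʳ i i≤m = trans (distribˡ _ _ _)
        (+-cong (trans (×-comm-* (m ∸ i) _ _) (×-congʳ (m ∸ i) (*-leftComm (z i) y _)))
                (trans (×-comm-* (suc (m ∸ i)) _ _)
                       (sym (×-cong e (*-congˡ (reflexive (≡.cong w e)))))))
        where e = ℕ.+-∸-assoc 1 i≤m

    ∂^ : ℕ → Seq → Seq
    ∂^ zero    z = z
    ∂^ (suc n) z = ∂^ n (∂ z)

    ∂^-cong : ∀ n {z w} → z ≐ w → ∂^ n z ≐ ∂^ n w
    ∂^-cong zero    z≐w = z≐w
    ∂^-cong (suc n) z≐w = ∂^-cong n (∂-cong z≐w)

    ∂^-+ : ∀ n z w → ∂^ n (λ i → z i + w i) ≐ λ k → ∂^ n z k + ∂^ n w k
    ∂^-+ zero    z w k = refl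
    ∂^-+ (suc n) z w k = trans (∂^-cong n (∂-+ z w) k) (∂^-+ n (∂ z) (∂ w) k)

    ∂^-*ˡ : ∀ n a z → ∂^ n (λ i → a * z i) ≐ λ k → a * ∂^ n z k
    ∂^-*ˡ zero    a z k = refl
    ∂^-*ˡ (suc n) a z k = trans (∂^-cong n (∂-*ˡ a z) k) (∂^-*ˡ n a (∂ z) k)

    ∂^-leibniz₀ : ∀ n z w →
      binomialConvolution n (λ k → ∂^ k z 0) (λ k → ∂^ k w 0) ≈ ∂^ n (z ⋆ w) 0
    ∂^-leibniz₀ zero    z w = +-identityʳ _
    ∂^-leibniz₀ (suc n) z w = begin
      binomialConvolution (suc n) (λ k → ∂^ k z 0) (λ k → ∂^ k w 0)
        ≈⟨ binomialConvolution-suc n (λ k → ∂^ k z 0) (λ k → ∂^ k w 0) ⟩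
      binomialConvolution n (λ k → ∂^ k (∂ z) 0) (λ k → ∂^ k w 0)
        + binomialConvolution n (λ k → ∂^ k z 0) (λ k → ∂^ k (∂ w) 0)
        ≈⟨ +-cong (∂^-leibniz₀ n (∂ z) w) (∂^-leibniz₀ n z (∂ w)) ⟩
      ∂^ n (∂ z ⋆ w) 0 + ∂^ n (z ⋆ ∂ w) 0
        ≈⟨ sym (∂^-+ n (∂ z ⋆ w) (z ⋆ ∂ w) 0) ⟩
      ∂^ n (λ i → (∂ z ⋆ w) i + (z ⋆ ∂ w) i) 0
        ≈⟨ ∂^-cong n (λ i → sym (∂-leibniz z w i)) 0 ⟩
      ∂^ (suc n) (z ⋆ w) 0 ∎

    -- fubini n x y is fubiniForm n (powers x) by definition.
    fubiniForm : ℕ → Seq → Carrier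
    fubiniForm n z = sumTo n (λ k → surjections n k × (z k * y ^ (n ∸ k)))

    fubiniForm-suc : ∀ n z → fubiniForm (suc n) z ≈ fubiniForm n (∂ z)
    fubiniForm-suc n z = begin
      fubiniForm (suc n) z
        ≈⟨ sumTo-dropFirst n _ refl ⟩
      sumTo n (λ j → surjections (suc n) (suc j) × u j)
        ≈⟨ sumTo-cong n (λ j _ → split j) ⟩
      sumTo n (λ j → P (suc j) + Q j)
        ≈⟨ sumTo-+ n (P ∘ suc) Q ⟩
      sumTo n (P ∘ suc) + sumTo n Q
        ≈⟨ +-congʳ (sym (sumTo-reindex n P P0≈0 Pn≈0)) ⟩
      sumTo n P + sumTo n Q
        ≈⟨ sym (sumTo-+ n P Q) ⟩
      sumTo n (λ k → P k + Q k)
        ≈⟨ sumTo-cong n collect ⟩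
      fubiniForm n (∂ z) ∎
      where
      u P Q : ℕ → Carrier
      u j = z (suc j) * y ^ (n ∸ j)
      P k = surjections n k × (k × (z k * y ^ (suc n ∸ k)))
      Q k = surjections n k × (suc k × u k)
      split : ∀ j → surjections (suc n) (suc j) × u j ≈ P (suc j) + Q j
      split j = begin
        surjections (suc n) (suc j) × u j
          ≈⟨ ×-congˡ (≡.trans (surjections-suc n j) (ℕ.*-distribʳ-+ (suc j) (surjections n (suc j)) (surjections n j))) ⟩
        (surjections n (suc j) ℕ.* suc j ℕ.+ surjections n j ℕ.* suc j) × u j
          ≈⟨ ×-homo-+ (u j) (surjections n (suc j) ℕ.* suc j) (surjections n j ℕ.* suc j) ⟩
        (surjections n (suc j) ℕ.* suc j) × u j + (surjections n j ℕ.* suc j) × u j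
          ≈⟨ sym (+-cong (×-assocˡ (u j) (surjections n (suc j)) (suc j)) (×-assocˡ (u j) (surjections n j) (suc j))) ⟩
        P (suc j) + Q j ∎
      P0≈0 : P 0 ≈ 0#
      P0≈0 = ×-zeroʳ (surjections n 0)
      Pn≈0 : P (suc n) ≈ 0#
      Pn≈0 = ×-congˡ (surjections-vanishes (ℕ.n<1+n n))
      collect : ∀ k → k ≤ n → P k + Q k ≈ surjections n k × (∂ z k * y ^ (n ∸ k))
      collect k k≤n = sym (begin
        s × (∂ z k * y ^ (n ∸ k))
          ≈⟨ ×-congʳ s (trans (distribʳ _ _ _) (+-cong (×-assoc-* k _ _) (×-assoc-* (suc k) _ _))) ⟩
        s × (k × ((y * z k) * y ^ (n ∸ k)) + suc k × u k)
          ≈⟨ ×-distrib-+ _ _ s ⟩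
        s × (k × ((y * z k) * y ^ (n ∸ k))) + Q k
          ≈⟨ +-congʳ (×-congʳ s (×-congʳ k (trans (*-xy∙z≈y∙xz y (z k) _)
               (*-congˡ (reflexive (≡.cong (y ^_) (≡.sym (ℕ.+-∸-assoc 1 k≤n)))))))) ⟩
        P k + Q k ∎)
        where s = surjections n k

    fubiniForm≈∂^ : ∀ n z → fubiniForm n z ≈ ∂^ n z 0
    fubiniForm≈∂^ zero    z = trans (+-identityʳ _) (*-identityʳ _)
    fubiniForm≈∂^ (suc n) z = trans (fubiniForm-suc n z) (fubiniForm≈∂^ n (∂ z))

  convolution-closedForm : ∀ x₁ x₂ y d → d * (x₂ - x₁) ≈ 1# → ∀ n →
    convolution n x₁ x₂ y ≈ d * (x₂ * fubini n x₂ y - x₁ * fubini n x₁ y)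
  convolution-closedForm x₁ x₂ y d d*[x₂-x₁]≈1 n = begin
    convolution n x₁ x₂ y
      ≈⟨ sumTo-cong n (λ k _ → ×-congʳ (n C k) (*-cong (F≈∂^ k x₁) (F≈∂^ (n ∸ k) x₂))) ⟩
    binomialConvolution n (λ k → ∂^ k (powers x₁) 0) (λ k → ∂^ k (powers x₂) 0)
      ≈⟨ ∂^-leibniz₀ n (powers x₁) (powers x₂) ⟩
    ∂^ n S 0
      ≈⟨ sym (trans (*-congʳ d*[x₂-x₁]≈1) (*-identityˡ _)) ⟩
    d * (x₂ - x₁) * ∂^ n S 0
      ≈⟨ trans (*-assoc _ _ _) (*-congˡ (sym (∂^-*ˡ n (x₂ - x₁) S 0))) ⟩
    d * ∂^ n (λ m → (x₂ - x₁) * S m) 0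
      ≈⟨ *-congˡ (∂^-cong n (λ m → trans (powers-⋆-geometric x₁ x₂ m) (+-congˡ (-‿distribˡ-* x₁ _))) 0) ⟩
    d * ∂^ n (λ m → x₂ * powers x₂ m + - x₁ * powers x₁ m) 0
      ≈⟨ *-congˡ (trans (∂^-+ n _ _ 0) (+-cong (∂^-*ˡ n x₂ _ 0) (∂^-*ˡ n (- x₁) _ 0))) ⟩
    d * (x₂ * ∂^ n (powers x₂) 0 + - x₁ * ∂^ n (powers x₁) 0)
      ≈⟨ *-congˡ (+-cong (*-congˡ (sym (F≈∂^ n x₂)))
                         (trans (sym (-‿distribˡ-* x₁ _)) (-‿cong (*-congˡ (sym (F≈∂^ n x₁)))))) ⟩
    d * (x₂ * fubini n x₂ y - x₁ * fubini n x₁ y) ∎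
    where
    open Derivation y
    S : Seq
    S = powers x₁ ⋆ powers x₂
    F≈∂^ : ∀ k x → fubini k x y ≈ ∂^ k (powers x) 0
    F≈∂^ k x = fubiniForm≈∂^ k (powers x)

mainTheorem9 : {c ℓ : Level} (R : CommutativeRing c ℓ) →
    let open CommutativeRing R in let open FubiniDefs R in
    (x₁ x₂ y : Carrier) → ¬ (x₁ ≈ 0#) → ¬ (x₂ ≈ 0#) → ¬ (y ≈ 0#) → ¬ (x₁ ≈ x₂) →
    (d : Carrier) → d * (x₂ - x₁) ≈ 1# →
    (n : ℕ) →
    convolution n x₁ x₂ y ≈ d * (x₂ * fubini n x₂ y - x₁ * fubini n x₁ y)
mainTheorem9 R x₁ x₂ y _ _ _ _ = FubiniConvolution.convolution-closedForm R x₁ x₂ y
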